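{- Let $t\ge1$ and let $\Phi$ be the $(8t+4)\times(8t+4)$ incidence matrix of a $\mathrm{PBIBD}(4)$ with parameters $v=b=8t+4$, $r=k=4t+2$, $\lambda_1=0$, $\lambda_2=2t+1$, $\lambda_3=2t+2$, $\lambda_4=2t$, with respect to the association scheme $A_0,\dots,A_4$ (classes $R_0,\dots,R_4$) defined below from some $(\pm1)$-matrix $M$. Let $E$ be a group with a central subgroup $\langle-1\rangle$ of order $2$, acting as a regular group of automorphisms of the design (regularly on points and regularly on blocks, preserving incidence), such that the design is $R_1$-class regular with respect to $\langle-1\rangle$ (i.e. $\langle-1\rangle$ acts regularly on each point class $\{i,i+4t+2\}$, $1\le i\le 4t+2$). Then there exists a relative $(4t+2,2,4t+2,2t+1)$-quasi-difference set in $E$ with forbidden subgroup $\langle-1\rangle$.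
   Context: $I,J$ denote identity and all-ones matrices, $\otimes$ the Kronecker product, $\mathrm{abs}$ entrywise absolute value. $M$ is a $(4t+2)\times(4t+2)$ $(\pm1)$-matrix with $\mathrm{abs}(MM^\top)=\begin{bmatrix}4tI_{2t+1}+2J_{2t+1}&0\\0&4tI_{2t+1}+2J_{2t+1}\end{bmatrix}$. With $K=I_2\otimes J_{2t+1}$, $\Delta_1=\tfrac14(MM^\top+2K-(4t+4)I)$, $\Delta_2=\tfrac14(2K+4tI-MM^\top)$: $A_0=I_{8t+4}$, $A_1=(J_2-I_2)\otimes I_{4t+2}$, $A_2=J_2\otimes(J_2-I_2)\otimes J_{2t+1}$, $A_3=I_2\otimes\Delta_1+(J_2-I_2)\otimes\Delta_2$, $A_4=I_2\otimes\Delta_2+(J_2-I_2)\otimes\Delta_1$, indexed by the point set $X=\{1,\dots,8t+4\}$, with $R_i=\{(x,y):(A_i)_{xy}=1\}$. A $\mathrm{PBIBD}(4)$ with parameters $v,b,r,k,\lambda_1,\dots,\lambda_4$ on this scheme: $b$ blocks of size $k$, each point in $r$ blocks, points $x,y$ with $(x,y)\in R_i$ ($i\ge1$) together in exactly $\lambda_i$ blocks; $\Phi$ has rows indexed by points and columns by blocks. For a group $E$ of order $8t+4$ and normal subgroup $Z$ of order $2$, a relative $(4t+2,2,4t+2,2t+1)$-quasi-difference set in $E$ with forbidden subgroup $Z$ is a transversal $R$ for $Z$ in $E$ containing a subset $S\subset R\setminus\{1\}$, $|S|=2t+1$, such that for all $x\in E\setminus Z$: $|R\cap xR|=2t+1$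 if $x\in sZ$ for some $s\in S$, and $|R\cap xR|\in\{2t,2t+2\}$ otherwise. -}

module Defs where

open import Data.Nat as ℕ using (ℕ; zero; suc)
open import Data.Integer as ℤ using (ℤ; +_; -[1+_]; ∣_∣)
open import Data.Integer.DivMod using (_/ℕ_)
open import Data.Fin as Fin using (Fin; zero; suc; toℕ)
open import Data.Bool using (Bool; true; false; if_then_else_; _∧_; _xor_)
open import Data.Product using (_×_; _,_; Σ; ∃!)
open import Data.Sum using (_⊎_)
open import Relation.Nullary using (¬_; does)
open import Relation.Binary.PropositionalEquality using (_≡_)
open import Algebra.Structures using (IsGroup)
open import Function.Bundles using (_↔_; Inverse)

∑ : ∀ {m} → (Fin m → ℤ) → ℤ
∑ {zero}  f = + 0
∑ {suc m} f = f zero ℤ.+ ∑ (λ i → f (suc i))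

count : ∀ {m} → (Fin m → Bool) → ℕ
count {zero}  p = 0
count {suc m} p = (if p zero then 1 else 0) ℕ.+ count (λ i → p (suc i))

Mat : Set → Set → Set
Mat A B = A → B → ℤ

_·ᵀ : ∀ {m n} → Mat (Fin m) (Fin n) → Mat (Fin m) (Fin m)
(M ·ᵀ) i j = ∑ (λ k → M i k ℤ.* M j k)

Iₘ : ∀ {m} → Mat (Fin m) (Fin m)
Iₘ i j = if does (i Fin.≟ j) then + 1 else + 0

Jₘ : ∀ {m} → Mat (Fin m) (Fin m)
Jₘ i j = + 1

-- Kronecker product of a 2×2 matrix with an n×n matrix;
-- the row/column index (a , i) corresponds to a·n + i.
_⊗_ : ∀ {n} → Mat (Fin 2) (Fin 2) → Mat (Fin n) (Fin n) →
      Mat (Fin 2 × Fin n) (Fin 2 × Fin n)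
(A ⊗ B) (a , i) (b , j) = A a b ℤ.* B i j

infixl 6 _⊕_ _⊖_
_⊕_ _⊖_ : ∀ {A B} → Mat A B → Mat A B → Mat A B
(X ⊕ Y) i j = X i j ℤ.+ Y i j
(X ⊖ Y) i j = X i j ℤ.- Y i j

infixl 7 _⊛_
_⊛_ : ∀ {A B} → ℤ → Mat A B → Mat A B
(c ⊛ X) i j = c ℤ.* X i j

-- entrywise exact quarter (all uses below are exact multiples of 4)
quarter : ∀ {A B} → Mat A B → Mat A B
quarter X i j = X i j /ℕ 4

nn : ℕ → ℕ
nn t = 4 ℕ.* t ℕ.+ 2

hh : ℕ → ℕ
hh t = 2 ℕ.* t ℕ.+ 1

firstBlock : (t : ℕ) → Fin (nn t) → Bool
firstBlock t i = toℕ i ℕ.<ᵇ hh t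

sameBlock : (t : ℕ) → Fin (nn t) → Fin (nn t) → Bool
sameBlock t i j = if firstBlock t i then firstBlock t j
                  else (if firstBlock t j then false else true)

-- K = I₂ ⊗ J_{2t+1}  (as an n×n matrix)
Kmat : (t : ℕ) → Mat (Fin (nn t)) (Fin (nn t))
Kmat t i j = if sameBlock t i j then + 1 else + 0

-- (J₂ - I₂) ⊗ J_{2t+1}  (as an n×n matrix)
offBlock : (t : ℕ) → Mat (Fin (nn t)) (Fin (nn t))
offBlock t = Jₘ ⊖ Kmat t

-- target of abs(M Mᵀ):  diag(4t I + 2 J, 4t I + 2 J)
absTarget : (t : ℕ) → Fin (nn t) → Fin (nn t) → ℕ
absTarget t i j = if sameBlock t i j
                  then (if does (i Fin.≟ j) then 4 ℕ.* t ℕ.+ 2 else 2)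
                  else 0

IsSchemeMatrix : (t : ℕ) → Mat (Fin (nn t)) (Fin (nn t)) → Set
IsSchemeMatrix t M =
  (∀ i j → M i j ≡ + 1 ⊎ M i j ≡ -[1+ 0 ])
  × (∀ i j → ∣ (M ·ᵀ) i j ∣ ≡ absTarget t i j)

Δ₁ : (t : ℕ) → Mat (Fin (nn t)) (Fin (nn t)) → Mat (Fin (nn t)) (Fin (nn t))
Δ₁ t M = quarter ((M ·ᵀ) ⊕ (+ 2 ⊛ Kmat t) ⊖ (+ (4 ℕ.* t ℕ.+ 4) ⊛ Iₘ))

Δ₂ : (t : ℕ) → Mat (Fin (nn t)) (Fin (nn t)) → Mat (Fin (nn t)) (Fin (nn t))
Δ₂ t M = quarter ((+ 2 ⊛ Kmat t) ⊕ (+ (4 ℕ.* t) ⊛ Iₘ) ⊖ (M ·ᵀ))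

Pt : ℕ → Set
Pt t = Fin 2 × Fin (nn t)

I₂ J₂ J₂-I₂ : Mat (Fin 2) (Fin 2)
I₂ = Iₘ
J₂ = Jₘ
J₂-I₂ = Jₘ ⊖ Iₘ

A₀ A₁ A₂ : (t : ℕ) → Mat (Pt t) (Pt t)
A₀ t = I₂ ⊗ Iₘ
A₁ t = J₂-I₂ ⊗ Iₘ
A₂ t = J₂ ⊗ offBlock t

A₃ A₄ : (t : ℕ) → Mat (Fin (nn t)) (Fin (nn t)) → Mat (Pt t) (Pt t)
A₃ t M = (I₂ ⊗ Δ₁ t M) ⊕ (J₂-I₂ ⊗ Δ₂ t M)
A₄ t M = (I₂ ⊗ Δ₂ t M) ⊕ (J₂-I₂ ⊗ Δ₁ t M)

Rel : ∀ {A} → Mat A A → A → A → Set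
Rel X x y = X x y ≡ + 1

NB : ℕ → ℕ
NB t = 8 ℕ.* t ℕ.+ 4

countPt : (t : ℕ) → (Pt t → Bool) → ℕ
countPt t p = count (λ i → p (zero , i)) ℕ.+ count (λ i → p (suc zero , i))

together : (t : ℕ) → (Pt t → Fin (NB t) → Bool) → Pt t → Pt t → ℕ
together t Φ x y = count (λ B → Φ x B ∧ Φ y B)

record IsPBIBD (t : ℕ) (M : Mat (Fin (nn t)) (Fin (nn t)))
               (Φ : Pt t → Fin (NB t) → Bool) : Set where
  field
    blockSize : ∀ B → countPt t (λ x → Φ x B) ≡ nn t
    replication : ∀ x → count (λ B → Φ x B) ≡ nn t
    λ₁ : ∀ x y → Rel (A₁ t) x y → together t Φ x y ≡ 0
    λ₂ : ∀ x y → Rel (A₂ t) x y → together t Φ x y ≡ 2 ℕ.* t ℕ.+ 1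
    λ₃ : ∀ x y → Rel (A₃ t M) x y → together t Φ x y ≡ 2 ℕ.* t ℕ.+ 2
    λ₄ : ∀ x y → Rel (A₄ t M) x y → together t Φ x y ≡ 2 ℕ.* t

-- Relative (4t+2, 2, 4t+2, 2t+1)-quasi-difference set in a group E
-- (carrier C, order 8t+4 via the enumeration enum) with forbidden
-- subgroup Z = {ε, z}.  Subsets of E are Boolean predicates.

record IsRelQDS (t : ℕ) {C : Set} (_∙_ : C → C → C) (ε : C) (_⁻¹ : C → C)
                (enum : Fin (NB t) ↔ C) (z : C) (R S : C → Bool) : Set where
  private
    el : Fin (NB t) → C
    el = Inverse.to enum
    -- |R ∩ xR|, where g ∈ xR iff x⁻¹ g ∈ R
    meet : C → ℕ
    meet x = count (λ i → R (el i) ∧ R ((x ⁻¹) ∙ el i))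
  field
    transversal : ∀ g → (R g xor R (g ∙ z)) ≡ true
    S⊆R : ∀ g → S g ≡ true → R g ≡ true
    1∉S : S ε ≡ false
    ∣S∣ : count (λ i → S (el i)) ≡ 2 ℕ.* t ℕ.+ 1
    inSZ : ∀ x → ¬ x ≡ ε → ¬ x ≡ z →
           (Σ C λ s → S s ≡ true × (x ≡ s ⊎ x ≡ s ∙ z)) →
           meet x ≡ 2 ℕ.* t ℕ.+ 1
    notInSZ : ∀ x → ¬ x ≡ ε → ¬ x ≡ z →
           ¬ (Σ C λ s → S s ≡ true × (x ≡ s ⊎ x ≡ s ∙ z)) →
           meet x ≡ 2 ℕ.* t ⊎ meet x ≡ 2 ℕ.* t ℕ.+ 2

module Submission where

-- Fix the base point x₀ = (0, i₀), i₀ in the first block, a base block B₀, and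
-- put R = { g ∈ E : x₀ ∈ g·B₀ }.  As E is regular on blocks, |R ∩ xR| is the
-- number of blocks through x₀ and x·x₀, i.e. λᵢ for the class Rᵢ ∋ (x₀, x·x₀).
--   * λ₁ = 0 and k = 4t+2 make every block contain exactly one point of each
--     R₁-class {(0,i),(1,i)}; as -1 swaps them, R is a transversal for ⟨-1⟩.
--   * With S = { g ∈ R : g·x₀ is outside the block of x₀ }, SZ is the set of
--     all such g: these give R₂-pairs (λ₂ = 2t+1), every other x ∉ ⟨-1⟩ gives
--     an R₃- or R₄-pair (λ₃ = 2t+2, λ₄ = 2t), and |S| = (4t+2)/2 = 2t+1.
-- The file develops counting over finite enumerations, regular actions, the
-- entries of the scheme matrices and the class property of the design, and
-- then carries out the construction inside E.

open import Defs
open import Data.Nat as ℕ using (ℕ; zero; suc; _+_; _∸_; _≤_; _≥_; z≤n; s≤s)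
import Data.Nat.Properties as ℕP
open import Data.Integer as ℤ using (ℤ; +_; -[1+_]; ∣_∣)
import Data.Integer.Properties as ℤP
open import Data.Integer.DivMod using (_/ℕ_)
open import Data.Fin as Fin using (Fin; zero; suc; toℕ; _↑ˡ_; _↑ʳ_)
import Data.Fin.Properties as FinP
open import Data.Bool using (Bool; true; false; if_then_else_; _∧_; _∨_; not; _xor_)
open import Data.Bool.Properties using (¬-not; ∧-zeroʳ; not-injective)
open import Data.Product using (_×_; _,_; Σ; ∃!; proj₁; proj₂)
open import Data.Sum using (_⊎_; inj₁; inj₂; [_,_]′)
open import Data.Empty using (⊥-elim)
open import Relation.Nullary using (¬_)
open import Relation.Nullary.Decidable using (dec-true; dec-false)
open import Relation.Binary.PropositionalEquality
open import Algebra.Structures using (IsGroup)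
open import Function.Base using (_∘_)
open import Function.Bundles using (_↔_; Inverse; mk↔ₛ′)
open import Function.Construct.Composition using (_↔-∘_)
open import Function.Construct.Symmetry using (↔-sym)
open import Function.Construct.Identity using (↔-id)
open import Data.Nat.Tactic.RingSolver using (solve-∀)
import Algebra.Properties.CommutativeMonoid.Sum as MonoidSum

open Inverse using (to; from; strictlyInverseˡ; strictlyInverseʳ)
open ≡-Reasoning

𝟙 : Bool → ℕ
𝟙 b = if b then 1 else 0

private module ℕSum = MonoidSum ℕP.+-0-commutativeMonoid

-- `count p` is the sum of the indicators of p (to reuse the library's sums).
count≡sum : ∀ {n} (p : Fin n → Bool) → count p ≡ ℕSum.sum (𝟙 ∘ p)
count≡sum {zero}  p = refl
count≡sum {suc n} p = cong (𝟙 (p zero) ℕ.+_) (count≡sum (p ∘ suc))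

count-cong : ∀ {n} {p q : Fin n → Bool} → (∀ i → p i ≡ q i) → count p ≡ count q
count-cong {zero}  e = refl
count-cong {suc n} e = cong₂ (λ a b → 𝟙 a + b) (e zero) (count-cong (e ∘ suc))

count-permute : ∀ {m n} (π : Fin m ↔ Fin n) (p : Fin n → Bool) →
                count p ≡ count (p ∘ to π)
count-permute π p = begin
  count p                          ≡⟨ count≡sum p ⟩
  ℕSum.sum (𝟙 ∘ p)                 ≡⟨ ℕSum.sum-permute (𝟙 ∘ p) π ⟩
  ℕSum.sum (𝟙 ∘ p ∘ to π)          ≡⟨ count≡sum (p ∘ to π) ⟨
  count (p ∘ to π)                 ∎

count-reindex : ∀ {m n} {A : Set} (e₁ : Fin m ↔ A) (e₂ : Fin n ↔ A) (p : A → Bool) →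
                count (p ∘ to e₁) ≡ count (p ∘ to e₂)
count-reindex e₁ e₂ p = begin
  count (p ∘ to e₁)                     ≡⟨ count-cong (λ i → cong p (strictlyInverseˡ e₂ (to e₁ i))) ⟨
  count (p ∘ to e₂ ∘ from e₂ ∘ to e₁)   ≡⟨ count-permute (↔-sym e₂ ↔-∘ e₁) (p ∘ to e₂) ⟨
  count (p ∘ to e₂)                     ∎

count-≤ : ∀ {n} (p : Fin n → Bool) → count p ≤ n
count-≤ {zero}  p = z≤n
count-≤ {suc n} p with p zero
... | true  = s≤s (count-≤ (p ∘ suc))
... | false = ℕP.m≤n⇒m≤1+n (count-≤ (p ∘ suc))

count≡0 : ∀ {n} (p : Fin n → Bool) → count p ≡ 0 → ∀ i → p i ≡ false
count≡0 {suc n} p c i with p zero in p₀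
count≡0 {suc n} p () i       | true
count≡0 {suc n} p c zero    | false = p₀
count≡0 {suc n} p c (suc i) | false = count≡0 (p ∘ suc) c i

count≡n : ∀ {n} (p : Fin n → Bool) → count p ≡ n → ∀ i → p i ≡ true
count≡n {suc n} p c i with p zero in p₀
count≡n {suc n} p c i       | false =
  ⊥-elim (ℕP.1+n≰n (subst (_≤ n) c (count-≤ (p ∘ suc))))
count≡n {suc n} p c zero    | true = p₀
count≡n {suc n} p c (suc i) | true = count≡n (p ∘ suc) (ℕP.suc-injective c) i

count-disjoint : ∀ {n} (p q : Fin n → Bool) → (∀ i → (p i ∧ q i) ≡ false) →
                 count p + count q ≡ count (λ i → p i ∨ q i)
count-disjoint {zero} p q d = refl
count-disjoint {suc n} p q d
  with p zero | q zero | d zero | count-disjoint (p ∘ suc) (q ∘ suc) (d ∘ suc)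
... | true  | true  | () | _
... | true  | false | _  | ih = cong suc ih
... | false | true  | _  | ih = trans (ℕP.+-suc _ _) (cong suc ih)
... | false | false | _  | ih = ih

count-+ : ∀ m {n} (p : Fin (m + n) → Bool) →
          count p ≡ count (λ i → p (i ↑ˡ n)) + count (λ j → p (m ↑ʳ j))
count-+ zero    p = refl
count-+ (suc m) p = trans (cong (𝟙 (p zero) ℕ.+_) (count-+ m (p ∘ suc)))
                          (sym (ℕP.+-assoc (𝟙 (p zero)) _ _))

count-≥ : ∀ n m → count {n} (λ i → not (toℕ i ℕ.<ᵇ m)) ≡ n ∸ m
count-≥ zero    m       = sym (ℕP.0∸n≡0 m)
count-≥ (suc n) zero    = cong suc (count-≥ n zero)
count-≥ (suc n) (suc m) = count-≥ n m

twoCopies : ∀ n → Fin (n + n) ↔ (Fin 2 × Fin n)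
twoCopies n = pairUp ↔-∘ FinP.+↔⊎
  where
  pairUp : (Fin n ⊎ Fin n) ↔ (Fin 2 × Fin n)
  pairUp = mk↔ₛ′ [ (zero ,_) , (suc zero ,_) ]′
                 (λ { (zero , i) → inj₁ i ; (suc zero , i) → inj₂ i })
                 (λ { (zero , i) → refl ; (suc zero , i) → refl })
                 (λ { (inj₁ i) → refl ; (inj₂ i) → refl })

count-twoCopies : ∀ n (p : Fin 2 × Fin n → Bool) →
                  count (p ∘ to (twoCopies n)) ≡
                  count (λ i → p (zero , i)) + count (λ i → p (suc zero , i))
count-twoCopies n p = trans (count-+ n (p ∘ to (twoCopies n)))
  (cong₂ _+_ (count-cong (λ i → cong (p ∘ side) (FinP.splitAt-↑ˡ n i n)))
             (count-cong (λ i → cong (p ∘ side) (FinP.splitAt-↑ʳ n n i))))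
  where
  side : Fin n ⊎ Fin n → Fin 2 × Fin n
  side = [ (zero ,_) , (suc zero ,_) ]′

count-transversal : ∀ {n} {A : Set} (e : Fin n ↔ A) (τ : A → A) → (∀ a → τ (τ a) ≡ a) →
  (R P : A → Bool) → (∀ a → (R a xor R (τ a)) ≡ true) → (∀ a → P (τ a) ≡ P a) →
  count (λ i → R (to e i) ∧ P (to e i)) + count (λ i → R (to e i) ∧ P (to e i))
  ≡ count (P ∘ to e)
count-transversal {A = A} e τ ττ R P one P-τ = begin
  count (S ∘ to e) + count (S ∘ to e)
    ≡⟨ cong (count (S ∘ to e) ℕ.+_) (count-reindex e (τ↔ ↔-∘ e) S) ⟩
  count (S ∘ to e) + count (S ∘ τ ∘ to e)
    ≡⟨ count-disjoint (S ∘ to e) (S ∘ τ ∘ to e) (disjoint ∘ to e) ⟩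
  count (λ i → S (to e i) ∨ S (τ (to e i)))
    ≡⟨ count-cong (cover ∘ to e) ⟩
  count (P ∘ to e) ∎
  where
  S : A → Bool
  S a = R a ∧ P a
  τ↔ : A ↔ A
  τ↔ = mk↔ₛ′ τ τ ττ ττ
  one-∧ : ∀ r s p → (r xor s) ≡ true → ((r ∧ p) ∧ (s ∧ p)) ≡ false
  one-∧ true  false p _ = ∧-zeroʳ p
  one-∧ false true  p _ = refl
  one-∨ : ∀ r s p → (r xor s) ≡ true → ((r ∧ p) ∨ (s ∧ p)) ≡ p
  one-∨ true  false true  _ = refl
  one-∨ true  false false _ = refl
  one-∨ false true  p     _ = refl
  disjoint : ∀ a → (S a ∧ S (τ a)) ≡ false
  disjoint a = trans (cong (λ q → S a ∧ (R (τ a) ∧ q)) (P-τ a))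
                     (one-∧ (R a) (R (τ a)) (P a) (one a))
  cover : ∀ a → (S a ∨ S (τ a)) ≡ P a
  cover a = trans (cong (λ q → S a ∨ (R (τ a) ∧ q)) (P-τ a))
                  (one-∨ (R a) (R (τ a)) (P a) (one a))

double-injective : ∀ m n → m + m ≡ n + n → m ≡ n
double-injective zero    zero    e = refl
double-injective (suc m) (suc n) e = cong suc (double-injective m n
  (ℕP.suc-injective (trans (sym (ℕP.+-suc m m)) (trans (ℕP.suc-injective e) (ℕP.+-suc n n)))))

module RegularAction {C X : Set} (act : C → X → X)
                     (regular : ∀ x y → ∃! _≡_ λ g → act g x ≡ y) (x₀ : X) where

  orbit↔ : C ↔ X
  orbit↔ = mk↔ₛ′ (λ g → act g x₀) (λ y → proj₁ (regular x₀ y))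
                 (λ y → proj₁ (proj₂ (regular x₀ y)))
                 (λ g → proj₂ (proj₂ (regular x₀ (act g x₀))) refl)

  orbit-injective : ∀ {g h} → act g x₀ ≡ act h x₀ → g ≡ h
  orbit-injective {g} {h} e = begin
    g                ≡⟨ strictlyInverseʳ orbit↔ g ⟨
    from orbit↔ (act g x₀) ≡⟨ cong (from orbit↔) e ⟩
    from orbit↔ (act h x₀) ≡⟨ strictlyInverseʳ orbit↔ h ⟩
    h                ∎

Iₘ-diag : ∀ {n} (i : Fin n) → Iₘ i i ≡ + 1
Iₘ-diag i = cong (if_then + 1 else + 0) (dec-true (i Fin.≟ i) refl)

Iₘ-offdiag : ∀ {n} {i j : Fin n} → ¬ i ≡ j → Iₘ i j ≡ + 0
Iₘ-offdiag {i = i} {j} i≢j = cong (if_then + 1 else + 0) (dec-false (i Fin.≟ j) i≢j)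

abs≡2 : ∀ m → ∣ m ∣ ≡ 2 → m ≡ + 2 ⊎ m ≡ -[1+ 1 ]
abs≡2 (+ 2)    _ = inj₁ refl
abs≡2 -[1+ 1 ] _ = inj₂ refl
abs≡2 (+ 0)    ()
abs≡2 (+ 1)    ()
abs≡2 (+ suc (suc (suc _))) ()
abs≡2 -[1+ 0 ] ()
abs≡2 -[1+ suc (suc _) ] ()

Complementary : ℤ → ℤ → Set
Complementary u v = (u ≡ + 1 × v ≡ + 0) ⊎ (u ≡ + 0 × v ≡ + 1)

-- The (a, b) entry of I₂ ⊗ u + (J₂ - I₂) ⊗ v.  The entries of A₃ and A₄ are
-- such mixtures of Δ₁ and Δ₂, with the roles of Δ₁ and Δ₂ exchanged.
blockMix : Fin 2 → Fin 2 → ℤ → ℤ → ℤ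
blockMix a b u v = I₂ a b ℤ.* u ℤ.+ J₂-I₂ a b ℤ.* v

blockMix-complementary : ∀ {u v} → Complementary u v →
                         ∀ a b → blockMix a b u v ≡ + 1 ⊎ blockMix a b v u ≡ + 1
blockMix-complementary (inj₁ (refl , refl)) zero       zero       = inj₁ refl
blockMix-complementary (inj₁ (refl , refl)) zero       (suc zero) = inj₂ refl
blockMix-complementary (inj₁ (refl , refl)) (suc zero) zero       = inj₂ refl
blockMix-complementary (inj₁ (refl , refl)) (suc zero) (suc zero) = inj₁ refl
blockMix-complementary (inj₂ (refl , refl)) zero       zero       = inj₂ refl
blockMix-complementary (inj₂ (refl , refl)) zero       (suc zero) = inj₁ refl
blockMix-complementary (inj₂ (refl , refl)) (suc zero) zero       = inj₁ refl
blockMix-complementary (inj₂ (refl , refl)) (suc zero) (suc zero) = inj₂ refl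

Δ₁-numerator : ∀ m {k ι} n → k ≡ + 1 → ι ≡ + 0 →
               m ℤ.+ + 2 ℤ.* k ℤ.- + n ℤ.* ι ≡ m ℤ.+ + 2
Δ₁-numerator m n refl refl rewrite ℤP.*-zeroʳ (+ n) = ℤP.+-identityʳ _

Δ₂-numerator : ∀ m {k ι} n → k ≡ + 1 → ι ≡ + 0 →
               + 2 ℤ.* k ℤ.+ + n ℤ.* ι ℤ.- m ≡ + 2 ℤ.- m
Δ₂-numerator m n refl refl rewrite ℤP.*-zeroʳ (+ n) = refl

module Scheme (t : ℕ) where

  Kmat-sameBlock : ∀ {i j} → sameBlock t i j ≡ true → Kmat t i j ≡ + 1
  Kmat-sameBlock = cong (if_then + 1 else + 0)

  A₁-class : ∀ i → Rel (A₁ t) (zero , i) (suc zero , i)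
  A₁-class i = cong ((Jₘ ⊖ Iₘ {2}) zero (suc zero) ℤ.*_) (Iₘ-diag i)

  A₂-offBlock : ∀ {i j} → sameBlock t i j ≡ false → ∀ a b → Rel (A₂ t) (a , i) (b , j)
  A₂-offBlock e a b = cong (λ s → + 1 ℤ.* (+ 1 ℤ.- (if s then + 1 else + 0))) e

  module _ (M : Mat (Fin (nn t)) (Fin (nn t))) (hM : IsSchemeMatrix t M) where

    MMᵀ-inBlock : ∀ {i j} → sameBlock t i j ≡ true → ¬ i ≡ j →
                  (M ·ᵀ) i j ≡ + 2 ⊎ (M ·ᵀ) i j ≡ -[1+ 1 ]
    MMᵀ-inBlock {i} {j} same i≢j = abs≡2 ((M ·ᵀ) i j) (trans (proj₂ hM i j) absTarget≡2)
      where
      absTarget≡2 : absTarget t i j ≡ 2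
      absTarget≡2 = cong₂ (λ s d → if s then (if d then 4 ℕ.* t ℕ.+ 2 else 2) else 0)
                          same (dec-false (i Fin.≟ j) i≢j)

    Δ₁-inBlock : ∀ {i j} → sameBlock t i j ≡ true → ¬ i ≡ j →
                 Δ₁ t M i j ≡ ((M ·ᵀ) i j ℤ.+ + 2) /ℕ 4
    Δ₁-inBlock {i} {j} same i≢j = cong (_/ℕ 4)
      (Δ₁-numerator ((M ·ᵀ) i j) (4 ℕ.* t ℕ.+ 4) (Kmat-sameBlock same) (Iₘ-offdiag i≢j))

    Δ₂-inBlock : ∀ {i j} → sameBlock t i j ≡ true → ¬ i ≡ j →
                 Δ₂ t M i j ≡ (+ 2 ℤ.- (M ·ᵀ) i j) /ℕ 4
    Δ₂-inBlock {i} {j} same i≢j = cong (_/ℕ 4)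
      (Δ₂-numerator ((M ·ᵀ) i j) (4 ℕ.* t) (Kmat-sameBlock same) (Iₘ-offdiag i≢j))

    -- Hence Δ₁ and Δ₂ are complementary there: (4/4, 0/4) or (0/4, 4/4).
    Δ-inBlock : ∀ {i j} → sameBlock t i j ≡ true → ¬ i ≡ j →
                Complementary (Δ₁ t M i j) (Δ₂ t M i j)
    Δ-inBlock same i≢j with MMᵀ-inBlock same i≢j
    ... | inj₁ m≡2  = inj₁ (trans (Δ₁-inBlock same i≢j) (cong (λ m → (m ℤ.+ + 2) /ℕ 4) m≡2)
                          , trans (Δ₂-inBlock same i≢j) (cong (λ m → (+ 2 ℤ.- m) /ℕ 4) m≡2))
    ... | inj₂ m≡-2 = inj₂ (trans (Δ₁-inBlock same i≢j) (cong (λ m → (m ℤ.+ + 2) /ℕ 4) m≡-2)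
                          , trans (Δ₂-inBlock same i≢j) (cong (λ m → (+ 2 ℤ.- m) /ℕ 4) m≡-2))

    A₃⊎A₄-inBlock : ∀ {i j} → sameBlock t i j ≡ true → ¬ i ≡ j →
                    ∀ a b → Rel (A₃ t M) (a , i) (b , j) ⊎ Rel (A₄ t M) (a , i) (b , j)
    A₃⊎A₄-inBlock same i≢j = blockMix-complementary (Δ-inBlock same i≢j)

-- Since λ₁ = 0 and every block has 4t+2 = (number of R₁-classes) points,
-- each block contains exactly one point of every R₁-class {(0,i),(1,i)}.
class-meets-block-once : ∀ {t M Φ} → IsPBIBD t M Φ →
                         ∀ i B → (Φ (zero , i) B xor Φ (suc zero , i) B) ≡ true
class-meets-block-once {t} {Φ = Φ} hΦ i B =
  exactly-one (Φ (zero , i) B) (Φ (suc zero , i) B) (not-both i) (some i)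
  where
  open IsPBIBD hΦ
  not-both : ∀ i → (Φ (zero , i) B ∧ Φ (suc zero , i) B) ≡ false
  not-both i = count≡0 _ (λ₁ (zero , i) (suc zero , i) (Scheme.A₁-class t i)) B
  some : ∀ i → (Φ (zero , i) B ∨ Φ (suc zero , i) B) ≡ true
  some = count≡n _ (trans (sym (count-disjoint _ _ not-both)) (blockSize B))
  exactly-one : ∀ r s → (r ∧ s) ≡ false → (r ∨ s) ≡ true → (r xor s) ≡ true
  exactly-one true  false _ _ = refl
  exactly-one false true  _ _ = refl

nn≡hh+hh : ∀ t → 4 ℕ.* t ℕ.+ 2 ≡ (2 ℕ.* t ℕ.+ 1) + (2 ℕ.* t ℕ.+ 1)
nn≡hh+hh = solve-∀

module Construction
  (t : ℕ) (M : Mat (Fin (nn t)) (Fin (nn t))) (hM : IsSchemeMatrix t M)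
  (Φ : Pt t → Fin (NB t) → Bool) (hΦ : IsPBIBD t M Φ)
  {C : Set} (_∙_ : C → C → C) (ε : C) (_⁻¹ : C → C) (group : IsGroup _≡_ _∙_ ε _⁻¹)
  (enum : Fin (NB t) ↔ C)
  (z : C) (z∙z : z ∙ z ≡ ε) (z-central : ∀ g → z ∙ g ≡ g ∙ z)
  (α : C → Pt t → Pt t) (β : C → Fin (NB t) → Fin (NB t))
  (α-ε : ∀ x → α ε x ≡ x) (α-∙ : ∀ g h x → α (g ∙ h) x ≡ α g (α h x))
  (β-∙ : ∀ g h B → β (g ∙ h) B ≡ β g (β h B))
  (α-regular : ∀ x y → ∃! _≡_ λ g → α g x ≡ y)
  (β-regular : ∀ B B′ → ∃! _≡_ λ g → β g B ≡ B′)
  (Φ-invariant : ∀ g x B → Φ (α g x) (β g B) ≡ Φ x B)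
  (z-swaps : ∀ i → α z (zero , i) ≡ (suc zero , i) × α z (suc zero , i) ≡ (zero , i))
  where

  open IsGroup group using (assoc; identityˡ; identityʳ; inverseʳ)
  open IsPBIBD hΦ using (λ₂; λ₃; λ₄)
  open Scheme t using (A₂-offBlock; A₃⊎A₄-inBlock)

  el : Fin (NB t) → C
  el = to enum

  nn-positive : 0 ℕ.< nn t
  nn-positive = ℕP.≤-trans (s≤s z≤n) (ℕP.m≤n+m 2 (4 ℕ.* t))

  i₀ : Fin (nn t)
  i₀ = Fin.fromℕ< nn-positive

  i₀-first : firstBlock t i₀ ≡ true
  i₀-first = trans (cong (ℕ._<ᵇ hh t) (FinP.toℕ-fromℕ< nn-positive))
                   (cong (0 ℕ.<ᵇ_) (ℕP.+-comm (2 ℕ.* t) 1))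

  x₀ x₁ : Pt t
  x₀ = (zero , i₀)
  x₁ = (suc zero , i₀)

  B₀ : Fin (NB t)
  B₀ = from enum ε

  sameBlock-i₀ : ∀ j → sameBlock t i₀ j ≡ firstBlock t j
  sameBlock-i₀ j = cong (λ b → if b then firstBlock t j else (if firstBlock t j then false else true))
                        i₀-first

  module Points = RegularAction α α-regular x₀
  module Blocks = RegularAction β β-regular B₀

  R Far S : C → Bool
  R g   = Φ x₀ (β g B₀)
  Far g = not (firstBlock t (proj₂ (α g x₀)))
  S g   = R g ∧ Far g

  -- |R ∩ xR| counts the blocks through x₀ and x·x₀.
  R-translate : ∀ x g → R ((x ⁻¹) ∙ g) ≡ Φ (α x x₀) (β g B₀)
  R-translate x g = begin
    Φ x₀ (β ((x ⁻¹) ∙ g) B₀)                   ≡⟨ Φ-invariant x x₀ _ ⟨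
    Φ (α x x₀) (β x (β ((x ⁻¹) ∙ g) B₀))       ≡⟨ cong (Φ (α x x₀)) (β-∙ x ((x ⁻¹) ∙ g) B₀) ⟨
    Φ (α x x₀) (β (x ∙ ((x ⁻¹) ∙ g)) B₀)       ≡⟨ cong (λ h → Φ (α x x₀) (β h B₀)) cancel ⟩
    Φ (α x x₀) (β g B₀)                        ∎
    where
    cancel : x ∙ ((x ⁻¹) ∙ g) ≡ g
    cancel = trans (sym (assoc x (x ⁻¹) g)) (trans (cong (_∙ g) (inverseʳ x)) (identityˡ g))

  meet≡together : ∀ x → count (λ i → R (el i) ∧ R ((x ⁻¹) ∙ el i)) ≡ together t Φ x₀ (α x x₀)
  meet≡together x =
    trans (count-cong (λ i → cong (R (el i) ∧_) (R-translate x (el i))))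
          (count-reindex (Blocks.orbit↔ ↔-∘ enum) (↔-id _) (λ B → Φ x₀ B ∧ Φ (α x x₀) B))

  α-z : ∀ g → α (g ∙ z) x₀ ≡ α z (α g x₀)
  α-z g = trans (cong (λ h → α h x₀) (sym (z-central g))) (α-∙ z g x₀)

  z-fixes-index : ∀ y → proj₂ (α z y) ≡ proj₂ y
  z-fixes-index (zero , i)     = cong proj₂ (proj₁ (z-swaps i))
  z-fixes-index (suc zero , i) = cong proj₂ (proj₂ (z-swaps i))

  Far-z : ∀ g → Far (g ∙ z) ≡ Far g
  Far-z g = cong (λ j → not (firstBlock t j)) (trans (cong proj₂ (α-z g)) (z-fixes-index _))

  R-z : ∀ g → R (g ∙ z) ≡ Φ x₁ (β g B₀)
  R-z g = begin
    Φ x₀ (β (g ∙ z) B₀)            ≡⟨ cong (λ h → Φ x₀ (β h B₀)) (z-central g) ⟨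
    Φ x₀ (β (z ∙ g) B₀)            ≡⟨ cong (Φ x₀) (β-∙ z g B₀) ⟩
    Φ x₀ (β z (β g B₀))            ≡⟨ cong (λ y → Φ y (β z (β g B₀))) (proj₂ (z-swaps i₀)) ⟨
    Φ (α z x₁) (β z (β g B₀))      ≡⟨ Φ-invariant z x₁ (β g B₀) ⟩
    Φ x₁ (β g B₀)                  ∎

  -- R is a transversal for ⟨z⟩, as g·B₀ contains exactly one of x₀, x₁.
  transversal : ∀ g → (R g xor R (g ∙ z)) ≡ true
  transversal g = trans (cong (R g xor_) (R-z g)) (class-meets-block-once hΦ i₀ (β g B₀))

  -- |Far| = 2(4t+2 ∸ (2t+1)) = 2(2t+1), read off in the point enumeration.
  count-Far : count (Far ∘ el) ≡ hh t + hh t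
  count-Far = begin
    count (Far ∘ el)
      ≡⟨ count-reindex (Points.orbit↔ ↔-∘ enum) (twoCopies (nn t)) farPoint ⟩
    count (farPoint ∘ to (twoCopies (nn t)))
      ≡⟨ count-twoCopies (nn t) farPoint ⟩
    count (λ i → farPoint (zero , i)) + count (λ i → farPoint (suc zero , i))
      ≡⟨ cong₂ _+_ (count-≥ (nn t) (hh t)) (count-≥ (nn t) (hh t)) ⟩
    (nn t ∸ hh t) + (nn t ∸ hh t)
      ≡⟨ cong (λ k → k + k) half ⟩
    hh t + hh t ∎
    where
    farPoint : Pt t → Bool
    farPoint y = not (firstBlock t (proj₂ y))
    half : nn t ∸ hh t ≡ hh t
    half = trans (cong (_∸ hh t) (nn≡hh+hh t)) (ℕP.m+n∸m≡n (hh t) (hh t))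

  z-involutive : ∀ g → (g ∙ z) ∙ z ≡ g
  z-involutive g = trans (assoc g z z) (trans (cong (g ∙_) z∙z) (identityʳ g))

  count-S : count (S ∘ el) ≡ hh t
  count-S = double-injective _ _
    (trans (count-transversal enum (_∙ z) z-involutive R Far transversal Far-z) count-Far)

  S⊆R : ∀ s → S s ≡ true → R s ≡ true
  S⊆R s Ss with R s
  ... | true = refl

  S⊆Far : ∀ s → S s ≡ true → Far s ≡ true
  S⊆Far s Ss with R s
  ... | true = Ss

  InSZ : C → Set
  InSZ x = Σ C λ s → S s ≡ true × (x ≡ s ⊎ x ≡ s ∙ z)

  -- SZ = Far: R selects one element of each ⟨z⟩-coset, and Far is z-invariant.
  InSZ⇒Far : ∀ x → InSZ x → Far x ≡ true
  InSZ⇒Far x (s , Ss , inj₁ x≡s)  = trans (cong Far x≡s) (S⊆Far s Ss)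
  InSZ⇒Far x (s , Ss , inj₂ x≡sz) = trans (cong Far x≡sz) (trans (Far-z s) (S⊆Far s Ss))

  Far⇒InSZ : ∀ x → Far x ≡ true → InSZ x
  Far⇒InSZ x far with R x in Rx
  ... | true  = x , cong₂ _∧_ Rx far , inj₁ refl
  ... | false = x ∙ z , cong₂ _∧_ Rxz (trans (Far-z x) far) , inj₂ (sym (z-involutive x))
    where
    Rxz : R (x ∙ z) ≡ true
    Rxz = trans (sym (cong (_xor R (x ∙ z)) Rx)) (transversal x)

  far⇒A₂ : ∀ x → Far x ≡ true → Rel (A₂ t) x₀ (α x x₀)
  far⇒A₂ x far =
    A₂-offBlock (trans (sameBlock-i₀ (proj₂ (α x x₀))) (not-injective far)) zero (proj₁ (α x x₀))

  class-of-x₀ : ∀ x b → α x x₀ ≡ (b , i₀) → x ≡ ε ⊎ x ≡ z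
  class-of-x₀ x zero       e = inj₁ (Points.orbit-injective (trans e (sym (α-ε x₀))))
  class-of-x₀ x (suc zero) e = inj₂ (Points.orbit-injective (trans e (sym (proj₁ (z-swaps i₀)))))

  near⇒A₃⊎A₄ : ∀ x → ¬ x ≡ ε → ¬ x ≡ z → Far x ≡ false →
               Rel (A₃ t M) x₀ (α x x₀) ⊎ Rel (A₄ t M) x₀ (α x x₀)
  near⇒A₃⊎A₄ x x≢ε x≢z near =
    A₃⊎A₄-inBlock M hM (trans (sameBlock-i₀ j) (not-injective near)) i₀≢j zero b
    where
    b : Fin 2
    b = proj₁ (α x x₀)
    j : Fin (nn t)
    j = proj₂ (α x x₀)
    i₀≢j : ¬ i₀ ≡ j
    i₀≢j i₀≡j = [ x≢ε , x≢z ]′ (class-of-x₀ x b (cong (b ,_) (sym i₀≡j)))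

  isQuasiDifferenceSet : IsRelQDS t _∙_ ε _⁻¹ enum z R S
  isQuasiDifferenceSet = record
    { transversal = transversal
    ; S⊆R         = S⊆R
    ; 1∉S         = 1∉S
    ; ∣S∣         = count-S
    ; inSZ        = λ x _ _ x∈SZ → trans (meet≡together x)
                                         (λ₂ x₀ (α x x₀) (far⇒A₂ x (InSZ⇒Far x x∈SZ)))
    ; notInSZ     = notInSZ
    }
    where
    1∉S : S ε ≡ false
    1∉S = trans (cong (λ y → R ε ∧ not (firstBlock t (proj₂ y))) (α-ε x₀))
                (trans (cong (λ b → R ε ∧ not b) i₀-first) (∧-zeroʳ (R ε)))
    notInSZ : ∀ x → ¬ x ≡ ε → ¬ x ≡ z → ¬ InSZ x →
              count (λ i → R (el i) ∧ R ((x ⁻¹) ∙ el i)) ≡ 2 ℕ.* t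
              ⊎ count (λ i → R (el i) ∧ R ((x ⁻¹) ∙ el i)) ≡ 2 ℕ.* t ℕ.+ 2
    notInSZ x x≢ε x≢z x∉SZ with near⇒A₃⊎A₄ x x≢ε x≢z (¬-not (x∉SZ ∘ Far⇒InSZ x))
    ... | inj₁ r₃ = inj₂ (trans (meet≡together x) (λ₃ x₀ (α x x₀) r₃))
    ... | inj₂ r₄ = inj₁ (trans (meet≡together x) (λ₄ x₀ (α x x₀) r₄))

theorem6 : (t : ℕ) → t ≥ 1 →
    (M : Mat (Fin (nn t)) (Fin (nn t))) → IsSchemeMatrix t M →
    (Φ : Pt t → Fin (NB t) → Bool) → IsPBIBD t M Φ →
    {C : Set} (_∙_ : C → C → C) (ε : C) (_⁻¹ : C → C) →
    IsGroup _≡_ _∙_ ε _⁻¹ →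
    (enum : Fin (NB t) ↔ C) →
    (z : C) → ¬ z ≡ ε → z ∙ z ≡ ε → (∀ g → z ∙ g ≡ g ∙ z) →
    (α : C → Pt t → Pt t) → (β : C → Fin (NB t) → Fin (NB t)) →
    (∀ x → α ε x ≡ x) → (∀ g h x → α (g ∙ h) x ≡ α g (α h x)) →
    (∀ B → β ε B ≡ B) → (∀ g h B → β (g ∙ h) B ≡ β g (β h B)) →
    (∀ x y → ∃! _≡_ λ g → α g x ≡ y) →
    (∀ B B′ → ∃! _≡_ λ g → β g B ≡ B′) →
    (∀ g x B → Φ (α g x) (β g B) ≡ Φ x B) →
    (∀ i → α z (zero , i) ≡ (suc zero , i) × α z (suc zero , i) ≡ (zero , i)) →
    Σ (C → Bool) λ R → Σ (C → Bool) λ S → IsRelQDS t _∙_ ε _⁻¹ enum z R S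
theorem6 t _ M hM Φ hΦ _∙_ ε _⁻¹ group enum z _ z∙z z-central α β α-ε α-∙ _ β-∙
         α-regular β-regular Φ-invariant z-swaps =
  R , S , isQuasiDifferenceSet
  where
  open Construction t M hM Φ hΦ _∙_ ε _⁻¹ group enum z z∙z z-central α β α-ε α-∙ β-∙
                    α-regular β-regular Φ-invariant z-swaps
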